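{- If $x\in S_1$, then every positive divisor of $x$ is in $S_1$.
   Context: Let $\overline{\psi}$ be the multiplicative arithmetic function with $\overline{\psi}(p^{\alpha})=p^{\alpha-1}(p+1)$ for odd primes $p$ and $\overline{\psi}(2^{\alpha})=2^{\alpha-1}$, for all positive integers $\alpha$ (so $\overline{\psi}(1)=1$). For $n>1$, $\lambda(n)$ is the unique nonnegative integer with $\overline{\psi}^{\lambda(n)}(n)=2$ (where $\overline{\psi}^k$ is the $k$-th iterate, $\overline{\psi}^0(n)=n$), and $\lambda(1)=0$. Define $g(k)$ for integers $k\geq 2$ by $g(k)=5^{k/3}$ if $k\equiv 0\pmod 3$, $g(k)=9\cdot 5^{(k-4)/3}$ if $k\equiv 1\pmod 3$, and $g(k)=3\cdot 5^{(k-2)/3}$ if $k\equiv 2\pmod 3$. The set $S_1$ consists of the number $1$ together with all positive integers $n$ with $\lambda(n)=k\geq 2$ and $n<2g(k)$ (no number $n$ with $\lambda(n)=1$ belongs to $S_1$, and $2\notin S_1$). -}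

module Defs where

open import Data.Nat using (ℕ; zero; suc; _+_; _*_; _∸_; _^_; _≤_; _<_; _≡ᵇ_; _/_; _%_)
open import Data.Nat.Primality using (prime?)
open import Data.List using (List; filter; upTo; map)
open import Data.Nat.ListAction using (product)
open import Data.Bool using (if_then_else_)
open import Data.Product using (Σ; _×_)
open import Data.Sum using (_⊎_)
open import Relation.Binary.PropositionalEquality using (_≡_)

-- p-adic valuation of n for p = 2 + q (with fuel; fuel n suffices for n ≥ 1)
valAux : ℕ → ℕ → ℕ → ℕ
valAux zero    q n = 0
valAux (suc f) q zero = 0
valAux (suc f) q (suc m) =
  if (suc m % (2 + q)) ≡ᵇ 0 then suc (valAux f q (suc m / (2 + q))) else 0

val : ℕ → ℕ → ℕ
val (suc (suc q)) n = valAux n q n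
val _ _ = 0

ψpp : ℕ → ℕ → ℕ
ψpp p zero = 1
ψpp 2 (suc a) = 2 ^ a
ψpp p (suc a) = p ^ a * (p + 1)

-- ψ̄ : the multiplicative function with ψ̄(p^a) = ψpp p a,
-- computed as the product over primes p ≤ n of ψpp p (v_p n).  ψ̄ 1 = 1.
ψ̄ : ℕ → ℕ
ψ̄ n = product (map (λ p → ψpp p (val p n)) (filter prime? (upTo (suc n))))

iterate : (ℕ → ℕ) → ℕ → ℕ → ℕ
iterate f zero    n = n
iterate f (suc k) n = iterate f k (f n)

-- λ(n) = k  iff  ψ̄^k(n) = 2  (such k is unique for n > 1, by definition of λ)
HasLambda : ℕ → ℕ → Set
HasLambda n k = iterate ψ̄ k n ≡ 2

g : ℕ → ℕ
g k with k % 3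
... | 0 = 5 ^ (k / 3)
... | 1 = 9 * 5 ^ ((k ∸ 4) / 3)
... | _ = 3 * 5 ^ ((k ∸ 2) / 3)

S₁ : ℕ → Set
S₁ n = n ≡ 1 ⊎ (1 ≤ n × Σ ℕ (λ k → 2 ≤ k × HasLambda n k × n < 2 * g k))

-- λ is governed by the completely additive function F with F p = 1 + F ⌊(p+1)/2⌋ on primes.
-- Comparing prime by prime, F (ψ̄ n) = F n for odd n and F (ψ̄ n) = F n − 1 for even n; as
-- ψ̄ n is even once n > 2, iterating gives λ n = F n for odd n > 1 and λ (2m) = F m.
-- Splitting n = m p off a prime p, induction shows G (F n) ≤ n for a submultiplicative G
-- that agrees with g from 2 on.  Hence an even n = 2m has n ≥ 2 G (F m) = 2 g (λ n), so S₁
-- is 1 together with the odd n < 2 G (F n).  Oddness passes to divisors, and if x = e d with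
-- 2 G (F d) ≤ d then 2 G (F x) ≤ 2 G (F e) G (F d) ≤ e d = x, so the bound passes too.
module Submission where

open import Defs
open import Data.Nat
open import Data.Nat.Properties
open import Data.Nat.DivMod using (m*n/n≡m; m/n<m; m/n≡1+[m∸n]/n; [m+n]%n≡m%n)
open import Data.Nat.Divisibility
open import Data.Nat.Primality
open import Data.Nat.Primality.Factorisation using (factorise)
open import Data.Nat.Induction using (<-rec)
open import Data.Bool using (true; false; if_then_else_; T)
open import Data.Unit using (tt)
open import Function using (_∘_; it)
open import Data.Fin using (Fin; toℕ; #_)
open import Data.Fin.Properties using (all?)
open import Relation.Nullary.Decidable using (from-yes)
open import Data.List using ([]; _∷_; _++_; [_]; map; filter; upTo)
open import Data.List.Relation.Unary.All using (_∷_)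
open import Data.List.Properties using (map-++; filter-++; upTo-∷ʳ)
open import Data.Nat.ListAction using (product)
open import Data.Nat.ListAction.Properties using (product-++)
open import Data.Product using (∃-syntax; _×_; _,_)
open import Data.Sum using (_⊎_; inj₁; inj₂; [_,_]′)
open import Relation.Binary.Definitions using (tri<; tri≈; tri>)
open import Relation.Nullary using (¬_; yes; no; does; contradiction)
open import Relation.Binary.PropositionalEquality using (_≡_; _≢_; refl; sym; trans; cong; cong₂; subst; ≢-sym; module ≡-Reasoning)
open import Algebra.Bundles using (CommutativeMonoid)
import Algebra.Properties.CommutativeSemigroup as CommSemigroupProperties
module + = CommSemigroupProperties +-commutativeSemigroup
module * = CommSemigroupProperties *-commutativeSemigroup

valAux-fuel : ∀ f f′ q n → n ≤ f → n ≤ f′ → valAux f q n ≡ valAux f′ q n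
valAux-fuel zero    zero     q n       _         _          = refl
valAux-fuel zero    (suc f′) q zero    _         _          = refl
valAux-fuel (suc f) zero     q zero    _         _          = refl
valAux-fuel (suc f) (suc f′) q zero    _         _          = refl
valAux-fuel (suc f) (suc f′) q (suc m) (s≤s m≤f) (s≤s m≤f′)
  with (suc m % (2 + q)) ≡ᵇ 0
... | true  = cong suc (valAux-fuel f f′ q _ (≤-trans m/p≤m m≤f) (≤-trans m/p≤m m≤f′))
  where m/p≤m = s≤s⁻¹ (m/n<m (suc m) (2 + q) (s≤s (s≤s z≤n)))
... | false = refl

valAux-∣ : ∀ f q n → 2 + q ∣ suc n → valAux (suc f) q (suc n) ≡ suc (valAux f q (suc n / (2 + q)))
valAux-∣ f q n p∣n rewrite n∣m⇒m%n≡0 (suc n) (2 + q) p∣n = refl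

valAux-∤ : ∀ f q n → ¬ 2 + q ∣ suc n → valAux (suc f) q (suc n) ≡ 0
valAux-∤ f q n p∤n with (suc n % (2 + q)) ≡ᵇ 0 in eq
... | true  = contradiction (m%n≡0⇒n∣m (suc n) (2 + q) (≡ᵇ⇒≡ _ 0 (subst T (sym eq) tt))) p∤n
... | false = refl

∤⇒nonZero : ∀ {p n} → ¬ p ∣ n → NonZero n
∤⇒nonZero {n = zero}  p∤0 = contradiction (_ ∣0) p∤0
∤⇒nonZero {n = suc n} _   = _

val-∤ : ∀ {p n} → .{{NonTrivial p}} → ¬ p ∣ n → val p n ≡ 0
val-∤ {2+ q} {zero}  p∤0 = contradiction (_ ∣0) p∤0
val-∤ {2+ q} {suc n} p∤n = valAux-∤ n q n p∤n

val-*p : ∀ {p} n → .{{NonTrivial p}} → .{{NonZero n}} → val p (n * p) ≡ suc (val p n)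
val-*p {2+ q} n@(suc k) = begin
  valAux (n * p) q (n * p)             ≡⟨ valAux-∣ f q f (n∣m*n n) ⟩
  suc (valAux f q (n * p / p))         ≡⟨ cong (suc ∘ valAux f q) (m*n/n≡m n p) ⟩
  suc (valAux f q n)                   ≡⟨ cong suc (valAux-fuel f n q n n≤f ≤-refl) ⟩
  suc (valAux n q n)                   ∎
  where open ≡-Reasoning
        p = 2 + q
        f = suc (q + k * p)
        n≤f : n ≤ f
        n≤f = s≤s (≤-trans (m≤m*n k p) (m≤n+m _ q))

val-*-∤ˡ : ∀ {p m} → Prime p → ¬ p ∣ m → ∀ n → .{{NonZero n}} → val p (m * n) ≡ val p n
val-*-∤ˡ {p} {m} pp@(prime _) p∤m = <-rec _ step
  where
  instance m≢0 = ∤⇒nonZero p∤m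
  step : ∀ n → (∀ {k} → k < n → .{{NonZero k}} → val p (m * k) ≡ val p k) →
         .{{NonZero n}} → val p (m * n) ≡ val p n
  step n rec with p ∣? n
  step .(k * p) rec | yes (divides-refl k) = begin
    val p (m * (k * p)) ≡⟨ cong (val p) (sym (*-assoc m k p)) ⟩
    val p (m * k * p)   ≡⟨ val-*p (m * k) ⟩
    suc (val p (m * k)) ≡⟨ cong suc (rec (m<m*n k p (nonTrivial⇒n>1 p))) ⟩
    suc (val p k)       ≡⟨ sym (val-*p k) ⟩
    val p (k * p)       ∎
    where open ≡-Reasoning
          instance k≢0 = m*n≢0⇒m≢0 k
                   mk≢0 = m*n≢0 m k
  ... | no p∤n = trans (val-∤ p∤mn) (sym (val-∤ p∤n))
    where p∤mn : ¬ p ∣ m * n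
          p∤mn p∣mn = [ p∤m , p∤n ]′ (euclidsLemma m n pp p∣mn)

val-* : ∀ {p} → Prime p → ∀ m n → .{{NonZero m}} → .{{NonZero n}} → val p (m * n) ≡ val p m + val p n
val-* {p} pp@(prime _) m n = <-rec _ step m
  where
  step : ∀ m → (∀ {k} → k < m → .{{NonZero k}} → val p (k * n) ≡ val p k + val p n) →
         .{{NonZero m}} → val p (m * n) ≡ val p m + val p n
  step m rec with p ∣? m
  step .(k * p) rec | yes (divides-refl k) = begin
    val p (k * p * n)           ≡⟨ cong (val p) (*.xy∙z≈xz∙y k p n) ⟩
    val p (k * n * p)           ≡⟨ val-*p (k * n) ⟩
    suc (val p (k * n))         ≡⟨ cong suc (rec (m<m*n k p (nonTrivial⇒n>1 p))) ⟩
    suc (val p k + val p n)     ≡⟨ cong (_+ val p n) (sym (val-*p k)) ⟩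
    val p (k * p) + val p n     ∎
    where open ≡-Reasoning
          instance k≢0 = m*n≢0⇒m≢0 k
                   kn≢0 = m*n≢0 k n
  ... | no p∤m = trans (val-*-∤ˡ pp p∤m n) (cong (_+ val p n) (sym (val-∤ p∤m)))

val-< : ∀ {p n} → .{{NonTrivial p}} → .{{NonZero n}} → n < p → val p n ≡ 0
val-< n<p = val-∤ (λ p∣n → <⇒≱ n<p (∣⇒≤ p∣n))

val-self : ∀ p → .{{NonTrivial p}} → val p p ≡ 1
val-self p = trans (cong (val p) (sym (*-identityˡ p))) (trans (val-*p 1) (cong suc (val-< {p} {1} (nonTrivial⇒n>1 p))))

val-prime-≢ : ∀ {p q} → Prime p → Prime q → p ≢ q → val p q ≡ 0
val-prime-≢ (prime _) qq@(prime _) p≢q = val-∤ λ p∣q →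
  [ nonTrivial⇒≢1 , p≢q ]′ (prime⇒irreducible qq p∣q)

^∣⇒≤val : ∀ {p n} a → .{{NonTrivial p}} → .{{NonZero n}} → p ^ a ∣ n → a ≤ val p n
^∣⇒≤val zero    _ = z≤n
^∣⇒≤val {p} (suc a) (divides-refl m) rewrite *-comm p (p ^ a) | sym (*-assoc m (p ^ a) p) =
  subst (suc a ≤_) (sym (val-*p (m * p ^ a))) (s≤s (^∣⇒≤val a (n∣m*n m)))
  where instance mpᵃ≢0 = m*n≢0⇒m≢0 (m * p ^ a)

∃-prime-divisor : ∀ n → .{{NonTrivial n}} → ∃[ p ] Prime p × p ∣ n
∃-prime-divisor n with factorise n {{nonTrivial⇒nonZero n}}
... | record { factors = [] ; isFactorisation = n≡1 } = contradiction n≡1 nonTrivial⇒≢1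
... | record { factors = p ∷ ps ; isFactorisation = n≡p*ps ; factorsPrime = pp ∷ _ } =
  p , pp , divides (product ps) (trans n≡p*ps (*-comm p (product ps)))

odd-prime-divisor⊎2∣ : ∀ n → .{{NonTrivial n}} → (∃[ p ] Prime p × p ≢ 2 × p ∣ n) ⊎ 2 ∣ n
odd-prime-divisor⊎2∣ n with ∃-prime-divisor n
... | p , pp , p∣n with p ≟ 2
...   | no  p≢2  = inj₁ (p , pp , p≢2 , p∣n)
...   | yes refl = inj₂ p∣n

odd-prime-divisor⊎4∣ : ∀ n → 2 < n → (∃[ p ] Prime p × p ≢ 2 × p ∣ n) ⊎ 4 ∣ n
odd-prime-divisor⊎4∣ n 2<n with odd-prime-divisor⊎2∣ n {{n>1⇒nonTrivial (<-trans (s≤s (s≤s z≤n)) 2<n)}}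
... | inj₁ odd-p∣n       = inj₁ odd-p∣n
... | inj₂ (divides-refl m) with odd-prime-divisor⊎2∣ m {{n>1⇒nonTrivial (*-cancelʳ-< 2 1 m 2<n)}}
...   | inj₁ (p , pp , p≢2 , p∣m) = inj₁ (p , pp , p≢2 , ∣-trans p∣m (m∣m*n 2))
...   | inj₂ (divides-refl k)      = inj₂ (divides k (*-assoc k 2 2))

¬2∣n⇒1+n≡⌊1+n/2⌋*2 : ∀ {n} → ¬ 2 ∣ n → suc n ≡ ⌊ suc n /2⌋ * 2
¬2∣n⇒1+n≡⌊1+n/2⌋*2 {0}    2∤0 = contradiction (2 ∣0) 2∤0
¬2∣n⇒1+n≡⌊1+n/2⌋*2 {1}    _   = refl
¬2∣n⇒1+n≡⌊1+n/2⌋*2 {2+ n} 2∤n = cong (2 +_) (¬2∣n⇒1+n≡⌊1+n/2⌋*2 (2∤n ∘ ∣m∣n⇒∣m+n (∣-refl {2})))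

prime≢2⇒odd : ∀ {p} → Prime p → p ≢ 2 → ¬ 2 ∣ p
prime≢2⇒odd pp p≢2 2∣p = [ (λ ()) , p≢2 ∘ sym ]′ (prime⇒irreducible pp 2∣p)

⌊1+p/2⌋<p : ∀ p → .{{NonTrivial p}} → ⌊ suc p /2⌋ < p
⌊1+p/2⌋<p (2+ q) = s≤s (⌊n/2⌋<n q)

⌊1+p/2⌋-nonZero : ∀ p → .{{NonTrivial p}} → NonZero ⌊ suc p /2⌋
⌊1+p/2⌋-nonZero (2+ q) = _

module PrimeFold {c ℓ} (M : CommutativeMonoid c ℓ) where
  open CommutativeMonoid M
    using (Carrier; _≈_; _∙_; ε; setoid; ∙-cong; ∙-congˡ; ∙-congʳ; assoc; identityˡ; identityʳ; commutativeSemigroup)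
    renaming (refl to ≈-refl; sym to ≈-sym)
  open import Relation.Binary.Reasoning.Setoid setoid
  open import Algebra.Properties.CommutativeSemigroup commutativeSemigroup using (xy∙z≈xz∙y; interchange)

  atPrime : ℕ → Carrier → Carrier
  atPrime n x = if does (prime? n) then x else ε

  fold : ℕ → (ℕ → Carrier) → Carrier
  fold zero    f = ε
  fold (suc N) f = fold N f ∙ atPrime (suc N) (f (suc N))

  atPrime-cong : ∀ n {x y} → (Prime n → x ≈ y) → atPrime n x ≈ atPrime n y
  atPrime-cong n x≈y with prime? n
  ... | yes pn = x≈y pn
  ... | no  _  = ≈-refl

  atPrime-prime : ∀ {n x} → Prime n → atPrime n x ≈ x
  atPrime-prime {n} pn with prime? n
  ... | yes _  = ≈-refl
  ... | no ¬pn = contradiction pn ¬pn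

  atPrime-ε : ∀ n → atPrime n ε ≈ ε
  atPrime-ε n with prime? n
  ... | yes _ = ≈-refl
  ... | no  _ = ≈-refl

  atPrime-∙ : ∀ n x y → atPrime n (x ∙ y) ≈ atPrime n x ∙ atPrime n y
  atPrime-∙ n x y with prime? n
  ... | yes _ = ≈-refl
  ... | no  _ = ≈-sym (identityˡ ε)

  fold-cong : ∀ N {f g} → (∀ {q} → Prime q → q ≤ N → f q ≈ g q) → fold N f ≈ fold N g
  fold-cong zero    f≈g = ≈-refl
  fold-cong (suc N) f≈g = ∙-cong (fold-cong N λ qq q≤N → f≈g qq (m≤n⇒m≤1+n q≤N))
                                 (atPrime-cong (suc N) λ pN → f≈g pN ≤-refl)

  fold-∙ : ∀ N f g → fold N (λ q → f q ∙ g q) ≈ fold N f ∙ fold N g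
  fold-∙ zero    f g = ≈-sym (identityˡ ε)
  fold-∙ (suc N) f g = begin
    fold N (λ q → f q ∙ g q) ∙ atPrime (suc N) (f (suc N) ∙ g (suc N))
      ≈⟨ ∙-cong (fold-∙ N f g) (atPrime-∙ (suc N) _ _) ⟩
    (fold N f ∙ fold N g) ∙ (atPrime (suc N) (f (suc N)) ∙ atPrime (suc N) (g (suc N)))
      ≈⟨ interchange _ _ _ _ ⟩
    fold (suc N) f ∙ fold (suc N) g ∎

  fold-trivial : ∀ N {f} → (∀ {q} → Prime q → q ≤ N → f q ≈ ε) → fold N f ≈ ε
  fold-trivial zero    f≈ε = ≈-refl
  fold-trivial (suc N) f≈ε = begin
    fold N _ ∙ atPrime (suc N) _ ≈⟨ ∙-cong (fold-trivial N λ qq q≤N → f≈ε qq (m≤n⇒m≤1+n q≤N))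
                                          (atPrime-cong (suc N) λ pN → f≈ε pN ≤-refl) ⟩
    ε ∙ atPrime (suc N) ε        ≈⟨ identityˡ _ ⟩
    atPrime (suc N) ε            ≈⟨ atPrime-ε (suc N) ⟩
    ε ∎

  fold-extend : ∀ {N} M {f} → N ≤ M → (∀ {q} → Prime q → N < q → f q ≈ ε) → fold M f ≈ fold N f
  fold-extend zero    z≤n  _   = ≈-refl
  fold-extend {N} (suc M) {f} N≤1+M f≈ε with m≤n⇒m<n∨m≡n N≤1+M
  ... | inj₂ refl = ≈-refl
  ... | inj₁ N<1+M = begin
    fold M f ∙ atPrime (suc M) (f (suc M)) ≈⟨ ∙-cong (fold-extend M (≤-pred N<1+M) f≈ε)
                                                      (atPrime-cong (suc M) λ pM → f≈ε pM N<1+M) ⟩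
    fold N f ∙ atPrime (suc M) ε            ≈⟨ ∙-congˡ (atPrime-ε (suc M)) ⟩
    fold N f ∙ ε                            ≈⟨ identityʳ _ ⟩
    fold N f                                ∎

  fold-adjust : ∀ {p} N {f g c} → Prime p → p ≤ N → g p ≈ f p ∙ c →
                (∀ {q} → Prime q → q ≢ p → g q ≈ f q) → fold N g ≈ fold N f ∙ c
  fold-adjust zero    pp z≤n _ _ = contradiction pp ¬prime[0]
  fold-adjust {p} (suc N) {f} {g} {c} pp p≤1+N gp≈fp∙c gq≈fq with m≤n⇒m<n∨m≡n p≤1+N
  ... | inj₂ refl = begin
    fold N g ∙ atPrime p (g p)       ≈⟨ ∙-cong (fold-cong N λ qq q≤N → gq≈fq qq (<⇒≢ (s≤s q≤N)))
                                                (atPrime-prime pp) ⟩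
    fold N f ∙ g p                   ≈⟨ ∙-congˡ gp≈fp∙c ⟩
    fold N f ∙ (f p ∙ c)             ≈⟨ ≈-sym (assoc _ _ _) ⟩
    fold N f ∙ f p ∙ c               ≈⟨ ∙-congʳ (∙-congˡ (≈-sym (atPrime-prime pp))) ⟩
    fold N f ∙ atPrime p (f p) ∙ c   ∎
  ... | inj₁ p<1+N = begin
    fold N g ∙ atPrime (suc N) (g (suc N))     ≈⟨ ∙-cong (fold-adjust N pp (≤-pred p<1+N) gp≈fp∙c gq≈fq)
                                                          (atPrime-cong (suc N) λ pN → gq≈fq pN (≢-sym (<⇒≢ p<1+N))) ⟩
    fold N f ∙ c ∙ atPrime (suc N) (f (suc N)) ≈⟨ xy∙z≈xz∙y _ _ _ ⟩
    fold N f ∙ atPrime (suc N) (f (suc N)) ∙ c ∎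

  fold-single : ∀ {p} N {f} → Prime p → p ≤ N → (∀ {q} → Prime q → q ≢ p → f q ≈ ε) → fold N f ≈ f p
  fold-single {p} N {f} pp p≤N fq≈ε = begin
    fold N f               ≈⟨ fold-adjust N {f = λ _ → ε} pp p≤N (≈-sym (identityˡ _)) fq≈ε ⟩
    fold N (λ _ → ε) ∙ f p ≈⟨ ∙-congʳ (fold-trivial N λ _ _ → ≈-refl) ⟩
    ε ∙ f p                ≈⟨ identityˡ _ ⟩
    f p                    ∎

module Σₚ = PrimeFold +-0-commutativeMonoid
module Πₚ = PrimeFold *-1-commutativeMonoid

Πₚ-atPrime-nonZero : ∀ n {x} → (Prime n → NonZero x) → NonZero (Πₚ.atPrime n x)
Πₚ-atPrime-nonZero n x≢0 with prime? n
... | yes pn = x≢0 pn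
... | no  _  = _

Πₚ-nonZero : ∀ N f → (∀ {q} → Prime q → NonZero (f q)) → NonZero (Πₚ.fold N f)
Πₚ-nonZero zero    f f≢0 = _
Πₚ-nonZero (suc N) f f≢0 = m*n≢0 _ _ {{Πₚ-nonZero N f f≢0}} {{Πₚ-atPrime-nonZero (suc N) f≢0}}

∣Πₚ : ∀ {p} N f → Prime p → p ≤ N → f p ∣ Πₚ.fold N f
∣Πₚ zero    f pp z≤n   = contradiction pp ¬prime[0]
∣Πₚ (suc N) f pp p≤1+N with m≤n⇒m<n∨m≡n p≤1+N
... | inj₂ refl  = ∣-trans (∣-reflexive (sym (Πₚ.atPrime-prime pp))) (n∣m*n (Πₚ.fold N f))
... | inj₁ p<1+N = ∣-trans (∣Πₚ N f pp (≤-pred p<1+N)) (m∣m*n _)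

-- The completely additive function F

-- F′ f n is F n computed with recursion depth f; depth n suffices (F′-fuel).
F′ : ℕ → ℕ → ℕ
F′ zero    n = 0
F′ (suc f) n = Σₚ.fold n (λ p → val p n * suc (F′ f ⌊ suc p /2⌋))

F : ℕ → ℕ
F n = F′ n n

F′-fuel : ∀ f f′ n → n ≤ f → n ≤ f′ → F′ f n ≡ F′ f′ n
F′-fuel zero    zero     n    _   _    = refl
F′-fuel zero    (suc f′) zero _   _    = refl
F′-fuel (suc f) zero     zero _   _    = refl
F′-fuel (suc f) (suc f′) n    n≤f n≤f′ = Σₚ.fold-cong n λ {q} (prime _) q≤n →
  cong (λ x → val q n * suc x) (F′-fuel f f′ _ (fuel-ok q≤n n≤f) (fuel-ok q≤n n≤f′))
  where fuel-ok : ∀ {q f} → .{{NonTrivial q}} → q ≤ n → n ≤ suc f → ⌊ suc q /2⌋ ≤ f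
        fuel-ok {q} q≤n n≤1+f = ≤-pred (<-≤-trans (⌊1+p/2⌋<p q) (≤-trans q≤n n≤1+f))

F-unfold : ∀ n → F n ≡ Σₚ.fold n (λ p → val p n * suc (F ⌊ suc p /2⌋))
F-unfold zero    = refl
F-unfold (suc m) = Σₚ.fold-cong (suc m) λ {q} (prime _) q≤n →
  cong (λ x → val q (suc m) * suc x) (F′-fuel m _ _ (≤-pred (<-≤-trans (⌊1+p/2⌋<p q) q≤n)) ≤-refl)

F-prime : ∀ {p} → Prime p → F p ≡ suc (F ⌊ suc p /2⌋)
F-prime {p} pp@(prime _) = begin
  F p                                                   ≡⟨ F-unfold p ⟩
  Σₚ.fold p (λ q → val q p * suc (F ⌊ suc q /2⌋))       ≡⟨ Σₚ.fold-single p pp ≤-refl vanishes-off-p ⟩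
  val p p * suc (F ⌊ suc p /2⌋)                         ≡⟨ cong (_* suc (F ⌊ suc p /2⌋)) (val-self p) ⟩
  1 * suc (F ⌊ suc p /2⌋)                               ≡⟨ *-identityˡ _ ⟩
  suc (F ⌊ suc p /2⌋)                                   ∎
  where open ≡-Reasoning
        vanishes-off-p : ∀ {q} → Prime q → q ≢ p → val q p * suc (F ⌊ suc q /2⌋) ≡ 0
        vanishes-off-p {q} qq q≢p = cong (_* suc (F ⌊ suc q /2⌋)) (val-prime-≢ qq pp q≢p)

F≡Σₚ : ∀ n → F n ≡ Σₚ.fold n (λ p → val p n * F p)
F≡Σₚ n = trans (F-unfold n) (Σₚ.fold-cong n λ {q} qq _ → cong (val q n *_) (sym (F-prime qq)))

F≡Σₚ-upTo : ∀ {n} N → .{{NonZero n}} → n ≤ N → F n ≡ Σₚ.fold N (λ p → val p n * F p)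
F≡Σₚ-upTo {n} N n≤N = trans (F≡Σₚ n) (sym (Σₚ.fold-extend N n≤N λ {q} (prime _) n<q → cong (_* F q) (val-< n<q)))

F-* : ∀ m n → .{{NonZero m}} → .{{NonZero n}} → F (m * n) ≡ F m + F n
F-* m n = begin
  F (m * n)                                                 ≡⟨ F≡Σₚ (m * n) ⟩
  Σₚ.fold (m * n) (λ p → val p (m * n) * F p)               ≡⟨ Σₚ.fold-cong (m * n) termwise ⟩
  Σₚ.fold (m * n) (λ p → val p m * F p + val p n * F p)     ≡⟨ Σₚ.fold-∙ (m * n) _ _ ⟩
  Σₚ.fold (m * n) (λ p → val p m * F p) +
    Σₚ.fold (m * n) (λ p → val p n * F p)                   ≡⟨ sym (cong₂ _+_ (F≡Σₚ-upTo (m * n) (m≤m*n m n))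
                                                                              (F≡Σₚ-upTo (m * n) (m≤n*m n m))) ⟩
  F m + F n                                                 ∎
  where open ≡-Reasoning
        termwise : ∀ {p} → Prime p → p ≤ m * n → val p (m * n) * F p ≡ val p m * F p + val p n * F p
        termwise {p} pp _ = trans (cong (_* F p) (val-* pp m n)) (*-distribʳ-+ (F p) (val p m) (val p n))

F-^ : ∀ n a → .{{NonZero n}} → F (n ^ a) ≡ a * F n
F-^ n zero    = refl
F-^ n (suc a) = trans (F-* n (n ^ a)) (cong (F n +_) (F-^ n a))
  where instance nᵃ≢0 = m^n≢0 n a

F-Πₚ : ∀ N f → (∀ {q} → Prime q → NonZero (f q)) → F (Πₚ.fold N f) ≡ Σₚ.fold N (λ q → F (f q))
F-Πₚ zero    f f≢0 = refl
F-Πₚ (suc N) f f≢0 = trans (F-* _ _ {{Πₚ-nonZero N f f≢0}} {{Πₚ-atPrime-nonZero (suc N) f≢0}})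
                           (cong₂ _+_ (F-Πₚ N f f≢0) (F-atPrime (suc N)))
  where F-atPrime : ∀ n {x} → F (Πₚ.atPrime n x) ≡ Σₚ.atPrime n (F x)
        F-atPrime n with prime? n
        ... | yes _ = refl
        ... | no  _ = refl

F-mono-∣ : ∀ {d n} → .{{NonZero n}} → d ∣ n → F d ≤ F n
F-mono-∣ {d} (divides-refl k) = subst (F d ≤_) (sym (F-* k d)) (m≤n+m (F d) (F k))
  where instance k≢0 = m*n≢0⇒m≢0 k
                 d≢0 = m*n≢0⇒n≢0 k

F-pos : ∀ n → .{{NonTrivial n}} → 0 < F n
F-pos n with ∃-prime-divisor n
... | p , pp , p∣n = <-≤-trans (subst (0 <_) (sym (F-prime pp)) z<s) (F-mono-∣ {{nonTrivial⇒nonZero n}} p∣n)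

F≡0⇒≡1 : ∀ n → .{{NonZero n}} → F n ≡ 0 → n ≡ 1
F≡0⇒≡1 1        _    = refl
F≡0⇒≡1 (2+ n) Fn≡0 = contradiction Fn≡0 (>⇒≢ (F-pos (2+ n)))

F-odd-prime : ∀ {p} → Prime p → p ≢ 2 → 2 ≤ F p
F-odd-prime {p} pp@(prime _) p≢2 = subst (2 ≤_) (sym (F-prime pp)) (s≤s (F-pos ⌊ suc p /2⌋))
  where instance
    ⌊1+p/2⌋>1 : NonTrivial ⌊ suc p /2⌋
    ⌊1+p/2⌋>1 = half-nonTrivial p p≢2
      where half-nonTrivial : ∀ p → .{{NonTrivial p}} → p ≢ 2 → NonTrivial ⌊ suc p /2⌋
            half-nonTrivial 2            p≢2 = contradiction refl p≢2
            half-nonTrivial (suc (2+ q)) _   = _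

F-odd : ∀ {n} → .{{NonTrivial n}} → ¬ 2 ∣ n → 2 ≤ F n
F-odd {n} 2∤n with ∃-prime-divisor n
... | p , pp , p∣n = ≤-trans (F-odd-prime pp p≢2) (F-mono-∣ {{nonTrivial⇒nonZero n}} p∣n)
  where p≢2 : p ≢ 2
        p≢2 refl = 2∤n p∣n

F-suc-odd-prime : ∀ {p} → Prime p → p ≢ 2 → F (suc p) ≡ F p
F-suc-odd-prime {p} pp@(prime _) p≢2 = begin
  F (suc p)               ≡⟨ cong F (¬2∣n⇒1+n≡⌊1+n/2⌋*2 (prime≢2⇒odd pp p≢2)) ⟩
  F (⌊ suc p /2⌋ * 2)     ≡⟨ F-* ⌊ suc p /2⌋ 2 {{⌊1+p/2⌋-nonZero p}} ⟩
  F ⌊ suc p /2⌋ + 1       ≡⟨ +-comm (F ⌊ suc p /2⌋) 1 ⟩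
  suc (F ⌊ suc p /2⌋)     ≡⟨ sym (F-prime pp) ⟩
  F p                     ∎
  where open ≡-Reasoning

product-filter-prime : ∀ N h → product (map h (filter prime? (upTo (suc N)))) ≡ Πₚ.fold N h
product-filter-prime zero    h = refl
product-filter-prime (suc N) h = begin
  product (map h (filter prime? (upTo (suc (suc N)))))
    ≡⟨ cong (λ xs → product (map h (filter prime? xs))) (sym (upTo-∷ʳ (suc N))) ⟩
  product (map h (filter prime? (upTo (suc N) ++ [ suc N ])))
    ≡⟨ cong (λ xs → product (map h xs)) (filter-++ prime? (upTo (suc N)) [ suc N ]) ⟩
  product (map h (filter prime? (upTo (suc N)) ++ filter prime? [ suc N ]))
    ≡⟨ cong product (map-++ h (filter prime? (upTo (suc N))) _) ⟩
  product (map h (filter prime? (upTo (suc N))) ++ map h (filter prime? [ suc N ]))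
    ≡⟨ product-++ (map h (filter prime? (upTo (suc N)))) _ ⟩
  product (map h (filter prime? (upTo (suc N)))) * product (map h (filter prime? [ suc N ]))
    ≡⟨ cong₂ _*_ (product-filter-prime N h) (singleton (suc N)) ⟩
  Πₚ.fold (suc N) h ∎
  where
  open ≡-Reasoning
  singleton : ∀ n → product (map h (filter prime? [ n ])) ≡ Πₚ.atPrime n (h n)
  singleton n with prime? n
  ... | yes _ = *-identityʳ (h n)
  ... | no  _ = refl

ψ̄≡Πₚ : ∀ n → ψ̄ n ≡ Πₚ.fold n (λ p → ψpp p (val p n))
ψ̄≡Πₚ n = product-filter-prime n _

ψpp-odd : ∀ {p} a → p ≢ 2 → ψpp p (suc a) ≡ p ^ a * (p + 1)
ψpp-odd {0}    a _   = refl
ψpp-odd {1}    a _   = refl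
ψpp-odd {2}    a p≢2 = contradiction refl p≢2
ψpp-odd {suc (2+ p)} a _ = refl

ψpp-nonZero : ∀ p a → .{{NonZero p}} → NonZero (ψpp p a)
ψpp-nonZero p        zero    = _
ψpp-nonZero 1        (suc a) = m*n≢0 (1 ^ a) 2 {{m^n≢0 1 a}}
ψpp-nonZero 2        (suc a) = m^n≢0 2 a
ψpp-nonZero (suc (2+ p)) (suc a) = m*n≢0 ((3 + p) ^ a) _ {{m^n≢0 (3 + p) a}}

ψpp-val-nonZero : ∀ n {q} → Prime q → NonZero (ψpp q (val q n))
ψpp-val-nonZero n {q} (prime _) = ψpp-nonZero q (val q n) {{nonTrivial⇒nonZero q}}

ψ̄-nonZero : ∀ n → NonZero (ψ̄ n)
ψ̄-nonZero n = subst NonZero (sym (ψ̄≡Πₚ n)) (Πₚ-nonZero n _ (ψpp-val-nonZero n))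

ψpp-∣-ψ̄ : ∀ {p n} → .{{NonZero n}} → Prime p → p ∣ n → ψpp p (val p n) ∣ ψ̄ n
ψpp-∣-ψ̄ {p} {n} pp p∣n = subst (ψpp p (val p n) ∣_) (sym (ψ̄≡Πₚ n)) (∣Πₚ n _ pp (∣⇒≤ p∣n))

2∣ψpp-odd : ∀ {p a} → Prime p → p ≢ 2 → 1 ≤ a → 2 ∣ ψpp p a
2∣ψpp-odd {p} {suc a} pp p≢2 _ = subst (2 ∣_) (sym (ψpp-odd a p≢2)) (∣-trans 2∣p+1 (n∣m*n (p ^ a)))
  where 2∣p+1 : 2 ∣ p + 1
        2∣p+1 = divides ⌊ suc p /2⌋ (trans (+-comm p 1) (¬2∣n⇒1+n≡⌊1+n/2⌋*2 (prime≢2⇒odd pp p≢2)))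

2∣ψpp-two : ∀ {a} → 2 ≤ a → 2 ∣ ψpp 2 a
2∣ψpp-two {suc (suc a)} _ = m∣m*n (2 ^ a)
2∣ψpp-two {1} (s≤s ())

2∣ψ̄ : ∀ n → 2 < n → 2 ∣ ψ̄ n
2∣ψ̄ n 2<n = [ via-odd-prime , via-4 ]′ (odd-prime-divisor⊎4∣ n 2<n)
  where
  instance n≢0 = >-nonZero (<-trans z<s 2<n)
  via-odd-prime : ∃[ p ] Prime p × p ≢ 2 × p ∣ n → 2 ∣ ψ̄ n
  via-odd-prime (p , pp@(prime _) , p≢2 , p∣n) =
    ∣-trans (2∣ψpp-odd pp p≢2 (^∣⇒≤val 1 (subst (_∣ n) (sym (*-identityʳ p)) p∣n))) (ψpp-∣-ψ̄ pp p∣n)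
  via-4 : 4 ∣ n → 2 ∣ ψ̄ n
  via-4 4∣n = ∣-trans (2∣ψpp-two (^∣⇒≤val 2 4∣n)) (ψpp-∣-ψ̄ prime[2] (∣-trans (divides 2 refl) 4∣n))

F-ψpp-odd : ∀ {p} a → Prime p → p ≢ 2 → F (ψpp p a) ≡ a * F p
F-ψpp-odd zero    _ _ = refl
F-ψpp-odd {p} (suc a) pp@(prime _) p≢2 = begin
  F (ψpp p (suc a))       ≡⟨ cong F (ψpp-odd a p≢2) ⟩
  F (p ^ a * (p + 1))     ≡⟨ F-* (p ^ a) (p + 1) {{m^n≢0 p a}} {{p+1≢0}} ⟩
  F (p ^ a) + F (p + 1)   ≡⟨ cong₂ _+_ (F-^ p a) (trans (cong F (+-comm p 1)) (F-suc-odd-prime pp p≢2)) ⟩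
  a * F p + F p           ≡⟨ +-comm (a * F p) (F p) ⟩
  suc a * F p             ∎
  where open ≡-Reasoning
        instance p≢0 = nonTrivial⇒nonZero p
        p+1≢0 = subst NonZero (+-comm 1 p) _

F-ψpp-two : ∀ a → F (ψpp 2 (suc a)) + 1 ≡ suc a * F 2
F-ψpp-two a = trans (cong (_+ 1) (F-^ 2 a)) (+-comm (a * F 2) 1)

F∘ψ̄ : ∀ n → F (ψ̄ n) ≡ Σₚ.fold n (λ p → F (ψpp p (val p n)))
F∘ψ̄ n = trans (cong F (ψ̄≡Πₚ n)) (F-Πₚ n _ (ψpp-val-nonZero n))

F-ψ̄-odd : ∀ {n} → ¬ 2 ∣ n → F (ψ̄ n) ≡ F n
F-ψ̄-odd {n} 2∤n = trans (F∘ψ̄ n) (trans (Σₚ.fold-cong n termwise) (sym (F≡Σₚ n)))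
  where
  termwise : ∀ {q} → Prime q → q ≤ n → F (ψpp q (val q n)) ≡ val q n * F q
  termwise {q} pq _ with q ≟ 2
  ... | yes refl rewrite val-∤ 2∤n = refl
  ... | no  q≢2  = F-ψpp-odd (val q n) pq q≢2

F-ψ̄-even : ∀ {n} → .{{NonZero n}} → 2 ∣ n → F (ψ̄ n) + 1 ≡ F n
F-ψ̄-even {n} 2∣n = begin
  F (ψ̄ n) + 1                                    ≡⟨ cong (_+ 1) (F∘ψ̄ n) ⟩
  Σₚ.fold n (λ p → F (ψpp p (val p n))) + 1      ≡⟨ Σₚ.fold-adjust n prime[2] (∣⇒≤ 2∣n) at-two at-odd ⟨
  Σₚ.fold n (λ p → val p n * F p)                ≡⟨ F≡Σₚ n ⟨
  F n                                            ∎
  where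
  open ≡-Reasoning
  at-two : val 2 n * F 2 ≡ F (ψpp 2 (val 2 n)) + 1
  at-two with val 2 n | ^∣⇒≤val {2} 1 2∣n
  ... | suc a | _ = sym (F-ψpp-two a)
  at-odd : ∀ {q} → Prime q → q ≢ 2 → val q n * F q ≡ F (ψpp q (val q n))
  at-odd {q} pq q≢2 = sym (F-ψpp-odd (val q n) pq q≢2)

-- λ in terms of F

iterate-+ : ∀ f m n x → iterate f (m + n) x ≡ iterate f n (iterate f m x)
iterate-+ f zero    n x = refl
iterate-+ f (suc m) n x = iterate-+ f m n (f x)

iterate-fixed : ∀ f {x} → f x ≡ x → ∀ k → iterate f k x ≡ x
iterate-fixed f fx≡x zero    = refl
iterate-fixed f fx≡x (suc k) = trans (cong (iterate f k) fx≡x) (iterate-fixed f fx≡x k)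

¬HasLambda-beyond : ∀ {n k k′} → HasLambda n k → k < k′ → ¬ HasLambda n k′
¬HasLambda-beyond {n} {k} {k′} hk k<k′ hk′ = contradiction (trans (sym hk′) ψ̄ᵏ′n≡1) λ ()
  where
  open ≡-Reasoning
  r = k′ ∸ suc k
  ψ̄ᵏ′n≡1 : iterate ψ̄ k′ n ≡ 1
  ψ̄ᵏ′n≡1 = begin
    iterate ψ̄ k′ n                    ≡⟨ cong (λ j → iterate ψ̄ j n) (trans (+-suc k r) (m+[n∸m]≡n k<k′)) ⟨
    iterate ψ̄ (k + suc r) n           ≡⟨ iterate-+ ψ̄ k (suc r) n ⟩
    iterate ψ̄ (suc r) (iterate ψ̄ k n) ≡⟨ cong (iterate ψ̄ (suc r)) hk ⟩
    iterate ψ̄ r 1                     ≡⟨ iterate-fixed ψ̄ refl r ⟩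
    1                                 ∎

HasLambda-unique : ∀ {n k k′} → HasLambda n k → HasLambda n k′ → k ≡ k′
HasLambda-unique {k = k} {k′} hk hk′ with <-cmp k k′
... | tri< k<k′ _ _ = contradiction hk′ (¬HasLambda-beyond hk k<k′)
... | tri≈ _ k≡k′ _ = k≡k′
... | tri> _ _ k′<k = contradiction hk (¬HasLambda-beyond hk′ k′<k)

HasLambda⇒nonTrivial : ∀ {n k} → .{{NonZero n}} → HasLambda n k → NonTrivial n
HasLambda⇒nonTrivial {1}    {k} hk = contradiction (trans (sym (iterate-fixed ψ̄ refl k)) hk) λ ()
HasLambda⇒nonTrivial {2+ n}     _  = _

hasLambda-even : ∀ t {n} → .{{NonZero n}} → 2 ∣ n → F n ≡ suc t → HasLambda n t
hasLambda-even zero    (divides-refl m) F[m*2]≡1 = cong (_* 2) (F≡0⇒≡1 m Fm≡0)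
  where instance m≢0 = m*n≢0⇒m≢0 m
        Fm≡0 : F m ≡ 0
        Fm≡0 = +-cancelʳ-≡ 1 (F m) 0 (trans (sym (F-* m 2)) F[m*2]≡1)
hasLambda-even (suc t) {n} 2∣n Fn≡2+t = hasLambda-even t {{ψ̄-nonZero n}} (2∣ψ̄ n 2<n) Fψ̄n≡1+t
  where 2<n : 2 < n
        2<n = ≤∧≢⇒< (∣⇒≤ 2∣n) λ 2≡n → contradiction (trans (cong F 2≡n) Fn≡2+t) λ ()
        Fψ̄n≡1+t : F (ψ̄ n) ≡ suc t
        Fψ̄n≡1+t = suc-injective (trans (+-comm 1 (F (ψ̄ n))) (trans (F-ψ̄-even 2∣n) Fn≡2+t))

hasLambda-odd : ∀ {n} → .{{NonTrivial n}} → ¬ 2 ∣ n → HasLambda n (F n)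
hasLambda-odd {n} 2∤n with F n in Fn≡ | F-pos n
... | suc t | _ = hasLambda-even t {{ψ̄-nonZero n}} (2∣ψ̄ n 2<n) (trans (F-ψ̄-odd 2∤n) Fn≡)
  where 2<n : 2 < n
        2<n = ≤∧≢⇒< (nonTrivial⇒n>1 n) λ 2≡n → 2∤n (∣-reflexive 2≡n)

hasLambda-double : ∀ m → .{{NonZero m}} → HasLambda (m * 2) (F m)
hasLambda-double m = hasLambda-even (F m) {{m*n≢0 m 2}} (n∣m*n m) (trans (F-* m 2) (+-comm (F m) 1))

-- The lower bound G

-- G agrees with g from 2 on (G≡g); G 0 and G 1 are the least n with F n = 0, 1.
G : ℕ → ℕ
G 0 = 1
G 1 = 2
G 2 = 3
G 3 = 5
G 4 = 9
G (suc (suc (suc (suc (suc k))))) = 5 * G (suc (suc k))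

G-+3 : ∀ k → 2 ≤ k → G (3 + k) ≡ 5 * G k
G-+3 (2+ k) _         = refl
G-+3 1      (s≤s ())

G-submultiplicative-table : ∀ (r s : Fin 5) → G (toℕ r + toℕ s) ≤ G (toℕ r) * G (toℕ s)
G-submultiplicative-table =
  from-yes (all? {n = 5} λ r → all? {n = 5} λ s → G (toℕ r + toℕ s) ≤? G (toℕ r) * G (toℕ s))

G-submultiplicativeˡ : ∀ (r : Fin 5) j → G (toℕ r + j) ≤ G (toℕ r) * G j
G-submultiplicativeˡ r 0 = G-submultiplicative-table r (# 0)
G-submultiplicativeˡ r 1 = G-submultiplicative-table r (# 1)
G-submultiplicativeˡ r 2 = G-submultiplicative-table r (# 2)
G-submultiplicativeˡ r 3 = G-submultiplicative-table r (# 3)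
G-submultiplicativeˡ r 4 = G-submultiplicative-table r (# 4)
G-submultiplicativeˡ r (suc (suc (suc (suc (suc j))))) = begin
  G (i + (5 + j))           ≡⟨ cong G (+.x∙yz≈y∙xz i 3 (2 + j)) ⟩
  G (3 + (i + (2 + j)))     ≡⟨ G-+3 (i + (2 + j)) (≤-trans (m≤m+n 2 j) (m≤n+m (2 + j) i)) ⟩
  5 * G (i + (2 + j))       ≤⟨ *-monoʳ-≤ 5 (G-submultiplicativeˡ r (suc (suc j))) ⟩
  5 * (G i * G (2 + j))     ≡⟨ *.x∙yz≈y∙xz 5 (G i) (G (2 + j)) ⟩
  G i * G (5 + j)           ∎
  where open ≤-Reasoning
        i = toℕ r

G-submultiplicative : ∀ i j → G (i + j) ≤ G i * G j
G-submultiplicative 0 j = G-submultiplicativeˡ (# 0) j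
G-submultiplicative 1 j = G-submultiplicativeˡ (# 1) j
G-submultiplicative 2 j = G-submultiplicativeˡ (# 2) j
G-submultiplicative 3 j = G-submultiplicativeˡ (# 3) j
G-submultiplicative 4 j = G-submultiplicativeˡ (# 4) j
G-submultiplicative (suc (suc (suc (suc (suc i))))) j = begin
  G (5 + i + j)           ≡⟨ G-+3 (2 + i + j) (m≤m+n 2 (i + j)) ⟩
  5 * G (2 + i + j)       ≤⟨ *-monoʳ-≤ 5 (G-submultiplicative (suc (suc i)) j) ⟩
  5 * (G (2 + i) * G j)   ≡⟨ *-assoc 5 (G (2 + i)) (G j) ⟨
  G (5 + i) * G j         ∎
  where open ≤-Reasoning

G-suc : ∀ j → 1 ≤ j → G (suc j) + 1 ≤ 2 * G j
G-suc 1 _ = ≤-refl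
G-suc 2 _ = ≤-refl
G-suc 3 _ = ≤-refl
G-suc 4 _ = ≤ᵇ⇒≤ 16 18 tt
G-suc (suc (suc (suc (suc (suc j))))) _ = begin
  5 * G (3 + j) + 1         ≤⟨ +-monoʳ-≤ (5 * G (3 + j)) (≤ᵇ⇒≤ 1 5 tt) ⟩
  5 * G (3 + j) + 5 * 1     ≡⟨ *-distribˡ-+ 5 (G (3 + j)) 1 ⟨
  5 * (G (3 + j) + 1)       ≤⟨ *-monoʳ-≤ 5 (G-suc (suc (suc j)) (s≤s z≤n)) ⟩
  5 * (2 * G (2 + j))       ≡⟨ *.x∙yz≈y∙xz 5 2 (G (2 + j)) ⟩
  2 * (5 * G (2 + j))       ∎
  where open ≤-Reasoning

G∘F-prime-≤ : ∀ {p} → Prime p → G (F ⌊ suc p /2⌋) ≤ ⌊ suc p /2⌋ → G (F p) ≤ p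
G∘F-prime-≤ {p} pp@(prime _) G[Fh]≤h = subst (λ k → G k ≤ p) (sym (F-prime pp)) (G-suc-≤ (F h) G[Fh]≤h)
  where
  h = ⌊ suc p /2⌋
  h+h≤1+p : h + h ≤ suc p
  h+h≤1+p = ≤-trans (+-monoʳ-≤ h (⌊n/2⌋≤⌈n/2⌉ (suc p))) (≤-reflexive (⌊n/2⌋+⌈n/2⌉≡n (suc p)))
  G-suc-≤ : ∀ j → G j ≤ h → G (suc j) ≤ p
  G-suc-≤ 0       _      = nonTrivial⇒n>1 p
  G-suc-≤ (suc j) Gj≤h = ≤-pred (begin
    suc (G (2 + j))   ≡⟨ +-comm 1 (G (2 + j)) ⟩
    G (2 + j) + 1     ≤⟨ G-suc (suc j) (s≤s z≤n) ⟩
    2 * G (suc j)     ≤⟨ *-monoʳ-≤ 2 Gj≤h ⟩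
    2 * h             ≡⟨ cong (h +_) (+-identityʳ h) ⟩
    h + h             ≤⟨ h+h≤1+p ⟩
    suc p             ∎)
    where open ≤-Reasoning

G∘F≤ : ∀ n → .{{NonZero n}} → G (F n) ≤ n
G∘F≤ = <-rec _ step
  where
  step : ∀ n → (∀ {k} → k < n → .{{NonZero k}} → G (F k) ≤ k) → .{{NonZero n}} → G (F n) ≤ n
  step 1      _   = ≤-refl
  step n@(2+ _) rec with ∃-prime-divisor n
  ... | p , pp@(prime _) , divides m n≡m*p = begin
    G (F n)                ≡⟨ cong (G ∘ F) n≡m*p ⟩
    G (F (m * p))          ≡⟨ cong G (F-* m p) ⟩
    G (F m + F p)          ≤⟨ G-submultiplicative (F m) (F p) ⟩
    G (F m) * G (F p)      ≤⟨ *-mono-≤ (rec m<n) (G∘F-prime-≤ pp (rec h<n {{⌊1+p/2⌋-nonZero p}})) ⟩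
    m * p                  ≡⟨ n≡m*p ⟨
    n                      ∎
    where
    open ≤-Reasoning
    instance m≢0 = m*n≢0⇒m≢0 m {{subst NonZero n≡m*p _}}
             p≢0 = nonTrivial⇒nonZero p
    m<n : m < n
    m<n = subst (m <_) (sym n≡m*p) (m<m*n m p (nonTrivial⇒n>1 p))
    h<n : ⌊ suc p /2⌋ < n
    h<n = <-≤-trans (⌊1+p/2⌋<p p) (∣⇒≤ (divides m n≡m*p))

g-by-residue : ℕ → ℕ → ℕ
g-by-residue 0      k = 5 ^ (k / 3)
g-by-residue 1      k = 9 * 5 ^ ((k ∸ 4) / 3)
g-by-residue (2+ _) k = 3 * 5 ^ ((k ∸ 2) / 3)

g≡g-by-residue : ∀ k → g k ≡ g-by-residue (k % 3) k
g≡g-by-residue k with k % 3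
... | 0    = refl
... | 1    = refl
... | 2+ _ = refl

[3+m]/3≡1+m/3 : ∀ m → (3 + m) / 3 ≡ suc (m / 3)
[3+m]/3≡1+m/3 m = m/n≡1+[m∸n]/n (m≤m+n 3 m)

g-by-residue-+3 : ∀ r j → r ≡ (2 + j) % 3 → g-by-residue r (5 + j) ≡ 5 * g-by-residue r (2 + j)
g-by-residue-+3 0      j      _ = cong (5 ^_) ([3+m]/3≡1+m/3 (2 + j))
g-by-residue-+3 1      0      ()
g-by-residue-+3 1      1      ()
g-by-residue-+3 1      (2+ j) _ = trans (cong (λ e → 9 * 5 ^ e) ([3+m]/3≡1+m/3 j)) (*.x∙yz≈y∙xz 9 5 (5 ^ (j / 3)))
g-by-residue-+3 (2+ _) j      _ = trans (cong (λ e → 3 * 5 ^ e) ([3+m]/3≡1+m/3 j)) (*.x∙yz≈y∙xz 3 5 (5 ^ (j / 3)))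

g-+3 : ∀ j → g (5 + j) ≡ 5 * g (2 + j)
g-+3 j = begin
  g (5 + j)                                ≡⟨ g≡g-by-residue (5 + j) ⟩
  g-by-residue ((5 + j) % 3) (5 + j)       ≡⟨ cong (λ r → g-by-residue r (5 + j)) 5+j≡2+j[mod3] ⟩
  g-by-residue ((2 + j) % 3) (5 + j)       ≡⟨ g-by-residue-+3 ((2 + j) % 3) j refl ⟩
  5 * g-by-residue ((2 + j) % 3) (2 + j)   ≡⟨ cong (5 *_) (g≡g-by-residue (2 + j)) ⟨
  5 * g (2 + j)                            ∎
  where open ≡-Reasoning
        5+j≡2+j[mod3] : (5 + j) % 3 ≡ (2 + j) % 3
        5+j≡2+j[mod3] = trans (cong (_% 3) (+-comm 3 (2 + j))) ([m+n]%n≡m%n (2 + j) 3)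

G≡g : ∀ k → 2 ≤ k → G k ≡ g k
G≡g 2 _ = refl
G≡g 3 _ = refl
G≡g 4 _ = refl
G≡g (suc (suc (suc (suc (suc j))))) _ = trans (cong (5 *_) (G≡g (suc (suc j)) (m≤m+n 2 j))) (sym (g-+3 j))
G≡g 1 (s≤s ())

2*G∘F≤-*ˡ : ∀ e d → .{{NonZero e}} → .{{NonZero d}} → 2 * G (F d) ≤ d → 2 * G (F (e * d)) ≤ e * d
2*G∘F≤-*ˡ e d 2G[Fd]≤d = begin
  2 * G (F (e * d))         ≡⟨ cong (λ k → 2 * G k) (F-* e d) ⟩
  2 * G (F e + F d)         ≤⟨ *-monoʳ-≤ 2 (G-submultiplicative (F e) (F d)) ⟩
  2 * (G (F e) * G (F d))   ≡⟨ *.x∙yz≈y∙xz 2 (G (F e)) (G (F d)) ⟩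
  G (F e) * (2 * G (F d))   ≤⟨ *-mono-≤ (G∘F≤ e) 2G[Fd]≤d ⟩
  e * d                     ∎
  where open ≤-Reasoning

<2G∘F-∣ : ∀ {d x} → .{{NonZero x}} → d ∣ x → x < 2 * G (F x) → d < 2 * G (F d)
<2G∘F-∣ {d} {x} (divides e x≡e*d) x<2G[Fx] with d <? 2 * G (F d)
... | yes d<2G[Fd] = d<2G[Fd]
... | no  d≮2G[Fd] = contradiction 2G[Fx]≤x (<⇒≱ x<2G[Fx])
  where instance e≢0 = m*n≢0⇒m≢0 e {{subst NonZero x≡e*d it}}
                 d≢0 = m*n≢0⇒n≢0 e {{subst NonZero x≡e*d it}}
        2G[Fx]≤x : 2 * G (F x) ≤ x
        2G[Fx]≤x = subst (λ y → 2 * G (F y) ≤ y) (sym x≡e*d) (2*G∘F≤-*ˡ e d (≮⇒≥ d≮2G[Fd]))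

2*g≤even : ∀ {n k} → .{{NonZero n}} → 2 ∣ n → HasLambda n k → 2 ≤ k → 2 * g k ≤ n
2*g≤even {n} {k} (divides m n≡m*2) λn≡k 2≤k = begin
  2 * g k          ≡⟨ cong (2 *_) (G≡g k 2≤k) ⟨
  2 * G k          ≡⟨ cong (λ j → 2 * G j) (HasLambda-unique {n} {k} {F m} λn≡k λn≡Fm) ⟩
  2 * G (F m)      ≤⟨ *-monoʳ-≤ 2 (G∘F≤ m) ⟩
  2 * m            ≡⟨ *-comm 2 m ⟩
  m * 2            ≡⟨ n≡m*2 ⟨
  n                ∎
  where
  open ≤-Reasoning
  instance m≢0 = m*n≢0⇒m≢0 m {{subst NonZero n≡m*2 it}}
  λn≡Fm : HasLambda n (F m)
  λn≡Fm = subst (λ y → HasLambda y (F m)) (sym n≡m*2) (hasLambda-double m)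

S₁⇒odd-bound : ∀ {n} → S₁ n → ¬ 2 ∣ n × n < 2 * G (F n)
S₁⇒odd-bound (inj₁ refl) = (λ 2∣1 → contradiction (∣1⇒≡1 2∣1) λ ()) , ≤-refl
S₁⇒odd-bound {n} (inj₂ (1≤n , k , 2≤k , λn≡k , n<2gk)) = 2∤n , n<2G[Fn]
  where
  instance
    n≢0 : NonZero n
    n≢0 = >-nonZero 1≤n
    n>1 : NonTrivial n
    n>1 = HasLambda⇒nonTrivial {n} {k} λn≡k
  2∤n : ¬ 2 ∣ n
  2∤n 2∣n = <⇒≱ n<2gk (2*g≤even 2∣n λn≡k 2≤k)
  n<2G[Fn] : n < 2 * G (F n)
  n<2G[Fn] rewrite HasLambda-unique {n} {F n} {k} (hasLambda-odd 2∤n) λn≡k | G≡g k 2≤k = n<2gk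

odd-bound⇒S₁ : ∀ n → ¬ 2 ∣ n → n < 2 * G (F n) → S₁ n
odd-bound⇒S₁ 0      2∤0 _ = contradiction (2 ∣0) 2∤0
odd-bound⇒S₁ 1      _   _ = inj₁ refl
odd-bound⇒S₁ n@(2+ _) 2∤n n<2G[Fn] =
  inj₂ (s≤s z≤n , F n , 2≤Fn , hasLambda-odd 2∤n , subst (λ j → n < 2 * j) (G≡g (F n) 2≤Fn) n<2G[Fn])
  where 2≤Fn = F-odd 2∤n

theorem2p6 : (x d : ℕ) → S₁ x → d ∣ x → S₁ d
theorem2p6 x d x∈S₁ d∣x with S₁⇒odd-bound x∈S₁
... | 2∤x , x<2G[Fx] =
  odd-bound⇒S₁ d (λ 2∣d → 2∤x (∣-trans 2∣d d∣x)) (<2G∘F-∣ {{∤⇒nonZero 2∤x}} d∣x x<2G[Fx])
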